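{- Permutation graphs are not closed under Hellification: there exists a permutation graph $G$ whose injective hull $\mathcal{H}(G)$ is not a permutation graph.
   Context: A permutation graph is the intersection graph of a family of segments joining points on two parallel lines, where each line carries points labeled $1,\dots,n$ and the segment labeled $i$ joins the two points labeled $i$. A graph is Helly if every family of pairwise intersecting disks $D(v,r)=\{u:d(u,v)\le r\}$ (shortest-path metric) has a common vertex. The injective hull $\mathcal{H}(G)$ of a connected graph $G$ is the unique minimal Helly graph containing $G$ as an isometric subgraph. A class $\mathcal{C}$ is closed under Hellification if $G\in\mathcal{C}$ implies $\mathcal{H}(G)\in\mathcal{C}$. -}

module Defs where

open import Data.Nat using (ℕ; zero; suc; _≤_)
open import Data.Fin using (Fin; _<_)
open import Data.Fin.Permutation using (Permutation′; _⟨$⟩ʳ_)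
open import Data.Bool using (Bool; true; false)
open import Data.Product using (Σ; ∃; ∃-syntax; _×_; _,_; proj₁)
open import Data.Sum using (_⊎_)
open import Relation.Binary.PropositionalEquality using (_≡_; _≢_)

record Graph : Set where
  field
    n     : ℕ
    adj   : Fin n → Fin n → Bool
    sym   : ∀ u v → adj u v ≡ adj v u
    irrefl : ∀ u → adj u u ≡ false

open Graph public

V : Graph → Set
V G = Fin (n G)

Edge : (G : Graph) → V G → V G → Set
Edge G u v = adj G u v ≡ true

data Walk (G : Graph) : ℕ → V G → V G → Set where
  here : ∀ u → Walk G 0 u u
  step : ∀ {k u v w} → Edge G u v → Walk G k v w → Walk G (suc k) u w

DistLE : (G : Graph) → V G → V G → ℕ → Set
DistLE G u v r = ∃[ k ] (k ≤ r × Walk G k u v)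

Connected : Graph → Set
Connected G = ∀ u v → ∃[ k ] Walk G k u v

InDisk : (G : Graph) → V G → ℕ → V G → Set
InDisk G v r u = DistLE G v u r

Helly : Graph → Set
Helly G = ∀ (m : ℕ) (c : Fin m → V G) (r : Fin m → ℕ) →
  (∀ i j → ∃[ w ] (InDisk G (c i) (r i) w × InDisk G (c j) (r j) w)) →
  ∃[ w ] (∀ i → InDisk G (c i) (r i) w)

-- Isometric embedding: a vertex map preserving the distance exactly
-- (hence injective and adjacency-preserving/reflecting, i.e. an isometric subgraph).
IsoEmb : Graph → Graph → Set
IsoEmb G H = Σ (V G → V H) λ f →
  ∀ u v r → (DistLE G u v r → DistLE H (f u) (f v) r) × (DistLE H (f u) (f v) r → DistLE G u v r)

emb : ∀ {G H} → IsoEmb G H → V G → V H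
emb = proj₁

-- H (with embedding f of G) is an injective hull of G: H is Helly, and minimal,
-- i.e. every Helly graph H' sitting isometrically between G and H (compatibly with f)
-- is all of H (the embedding H' → H is surjective).
IsInjectiveHull : (G H : Graph) → IsoEmb G H → Set
IsInjectiveHull G H f = Helly H ×
  (∀ (H' : Graph) (g : IsoEmb G H') (h : IsoEmb H' H) → Helly H' →
     (∀ u → emb {H'} {H} h (emb {G} {H'} g u) ≡ emb {G} {H} f u) →
     ∀ y → ∃[ x ] (emb {H'} {H} h x ≡ y))

-- Segments i and j cross: top endpoints at π₁ i, π₁ j, bottom endpoints at π₂ i, π₂ j.
Cross : ∀ {m} → Permutation′ m → Permutation′ m → Fin m → Fin m → Set
Cross π₁ π₂ i j =
  ((π₁ ⟨$⟩ʳ i) < (π₁ ⟨$⟩ʳ j) × (π₂ ⟨$⟩ʳ j) < (π₂ ⟨$⟩ʳ i)) ⊎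
  ((π₁ ⟨$⟩ʳ j) < (π₁ ⟨$⟩ʳ i) × (π₂ ⟨$⟩ʳ i) < (π₂ ⟨$⟩ʳ j))

PermutationGraph : Graph → Set
PermutationGraph G = Σ (Permutation′ (n G)) λ π₁ → Σ (Permutation′ (n G)) λ π₂ →
  ∀ i j → i ≢ j → (Edge G i j → Cross π₁ π₂ i j) × (Cross π₁ π₂ i j → Edge G i j)

module Submission where

-- The witness is a six-vertex permutation graph G₆ whose injective hull is an
-- eight-vertex graph H₈ obtained by adding two vertices (1 and 0 below).  If the extended map is
--     isometric on an anchor set whose distances pin down all others, it is an
--     isometric embedding.
-- For the example, every Helly graph containing G₆ isometrically therefore
-- contains H₈ isometrically.  This yields both the minimality of H₈ (the
-- anchors resolve H₈, so any self-embedding fixing G₆ is the identity) and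
-- the fact that no injective hull of G₆ is a permutation graph (H₈ has a
-- self-reversing forcing chain, and such chains survive isometric embeddings).

open import Defs
open import Data.Product using (Σ; _×_)
open import Relation.Nullary using (¬_)

open import Data.Bool using (true; false)
import Data.Bool.Properties as Bool
open import Data.Empty using (⊥-elim)
open import Data.Fin using (Fin; zero; suc; _<_; punchIn; punchOut)
import Data.Fin.Properties as Fin
open import Data.Fin.Properties using (all?; any?; punchIn-punchOut)
open import Data.Fin.Patterns using (0F; 1F; 2F; 3F; 4F; 5F; 7F)
open import Data.Fin.Permutation using (Permutation′; _⟨$⟩ʳ_; _∘ₚ_; transpose)
import Data.Fin.Permutation as Perm
open import Data.Nat using (ℕ; zero; suc; _+_; _∸_; _≤_; _≤?_; _<?_; _⊓_; _⊔_; _≡ᵇ_; z≤n; s≤s)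
import Data.Nat.Properties as ℕ
open import Data.Nat.Properties
  using (≤-refl; ≤-reflexive; ≤-trans; ≤-antisym; +-mono-≤; <⇒≤; <⇒≱; ≰⇒>;
         m≤n+o⇒m∸n≤o; m+[n∸m]≡n; m⊓n≤m; m⊓n≤n; ⊔-lub; +-cancelˡ-≤; +-cancelʳ-≤)
open import Data.Product using (∃-syntax; ∃₂; _,_; proj₁; proj₂; swap)
open import Data.Sum using (_⊎_; inj₁; inj₂)
open import Data.Vec using (Vec; []; _∷_; lookup)
import Data.Vec.Functional as Vector
open import Function using (_∘_; id)
open import Function.Bundles using (Injection)
open import Function.Properties.Inverse using (↔⇒↣)
open import Relation.Binary using (tri<; tri≈; tri>)
open import Relation.Binary.Construct.Closure.ReflexiveTransitive using (Star; ε; _◅_; gmap)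
open import Relation.Binary.PropositionalEquality as ≡ using (_≡_; _≢_; refl; cong; subst; subst₂)
open import Relation.Nullary using (Dec; yes; no)
open import Relation.Nullary.Decidable using (True; toWitness; from-yes; map′; _×-dec_; _⊎-dec_; _→-dec_)

Far : (K : Graph) → V K → V K → Set
Far K u v = ¬ DistLE K u v 1

module _ {K : Graph} where

  edge-sym : ∀ {u v} → Edge K u v → Edge K v u
  edge-sym {u} {v} e = ≡.trans (sym K v u) e

  edge-distinct : ∀ {u v} → Edge K u v → u ≢ v
  edge-distinct {u} e refl with ≡.trans (≡.sym e) (irrefl K u)
  ... | ()

  walk-snoc : ∀ {k u v w} → Walk K k u v → Edge K v w → Walk K (suc k) u w
  walk-snoc (here u)   e′ = step e′ (here _)
  walk-snoc (step e p) e′ = step e (walk-snoc p e′)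

  walk-reverse : ∀ {k u v} → Walk K k u v → Walk K k v u
  walk-reverse (here u)   = here u
  walk-reverse (step e p) = walk-snoc (walk-reverse p) (edge-sym e)

  walk-append : ∀ {k l u v w} → Walk K k u v → Walk K l v w → Walk K (k + l) u w
  walk-append (here u)   q = q
  walk-append (step e p) q = step e (walk-append p q)

  walk-split : ∀ r {t u v} → Walk K (r + t) u v → ∃[ w ] Walk K r u w × Walk K t w v
  walk-split zero    p = _ , here _ , p
  walk-split (suc r) (step e p) with walk-split r p
  ... | w , p₁ , p₂ = w , step e p₁ , p₂

  dist-refl : ∀ {u r} → DistLE K u u r
  dist-refl {u} = 0 , z≤n , here u

  dist-sym : ∀ {u v r} → DistLE K u v r → DistLE K v u r
  dist-sym (k , k≤r , p) = k , k≤r , walk-reverse p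

  dist-trans : ∀ {u v w r s} → DistLE K u v r → DistLE K v w s → DistLE K u w (r + s)
  dist-trans (k , k≤r , p) (l , l≤s , q) = k + l , +-mono-≤ k≤r l≤s , walk-append p q

  dist-mono : ∀ {u v r s} → r ≤ s → DistLE K u v r → DistLE K u v s
  dist-mono r≤s (k , k≤r , p) = k , ≤-trans k≤r r≤s , p

  dist-zero : ∀ {u v} → DistLE K u v 0 → u ≡ v
  dist-zero (0 , _ , here _) = refl

  edge-dist : ∀ {u v} → Edge K u v → DistLE K u v 1
  edge-dist {v = v} e = 1 , ≤-refl , step e (here v)

  dist-edge : ∀ {u v} → DistLE K u v 1 → u ≢ v → Edge K u v
  dist-edge (0 , _ , here _)           u≢v = ⊥-elim (u≢v refl)
  dist-edge (1 , _ , step e (here _))  _   = e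
  dist-edge (suc (suc _) , s≤s () , _) _

  disks-meet : ∀ r s {u v} → DistLE K u v (r + s) → ∃[ w ] DistLE K u w r × DistLE K w v s
  disks-meet r s (k , k≤r+s , p) with k ≤? r
  ... | yes k≤r = _ , (k , k≤r , p) , dist-refl
  ... | no  k≰r with walk-split r (subst (λ j → Walk K j _ _) (≡.sym (m+[n∸m]≡n (<⇒≤ (≰⇒> k≰r)))) p)
  ...   | w , p₁ , p₂ = w , (r , ≤-refl , p₁) , (k ∸ r , m≤n+o⇒m∸n≤o k r k≤r+s , p₂)

Descent : (K : Graph) → (V K → V K → ℕ) → V K → V K → ℕ → Set
Descent K d u v zero    = u ≡ v
Descent K d u v (suc k) = ∃[ z ] Edge K u z × d z v ≡ k

-- A table that vanishes on the diagonal, grows by at most one along an edge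
-- and admits descents everywhere is exactly the shortest-path distance.
record IsDistance (K : Graph) (d : V K → V K → ℕ) : Set where
  field
    diagonal  : ∀ u → d u u ≡ 0
    lipschitz : ∀ u z w → Edge K u z → d u w ≤ suc (d z w)
    descent   : ∀ u v → Descent K d u v (d u v)

module Distance {K : Graph} {d : V K → V K → ℕ} (isDistance : IsDistance K d) where
  open IsDistance isDistance

  walk-bound : ∀ {k u v} → Walk K k u v → d u v ≤ k
  walk-bound (here u)                           = ≤-reflexive (diagonal u)
  walk-bound (step {u = u} {v = z} {w = w} e p) = ≤-trans (lipschitz u z w e) (s≤s (walk-bound p))

  descent-walk : ∀ k {u v} → Descent K d u v k → Walk K k u v
  descent-walk zero    refl                     = here _
  descent-walk (suc k) {v = v} (z , e , dz≡k) =
    step e (descent-walk k (subst (Descent K d z v) dz≡k (descent z v)))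

  complete : ∀ {u v r} → DistLE K u v r → d u v ≤ r
  complete (k , k≤r , p) = ≤-trans (walk-bound p) k≤r

  sound : ∀ {u v r} → d u v ≤ r → DistLE K u v r
  sound {u} {v} le = d u v , le , descent-walk (d u v) (descent u v)

  realised : ∀ u v → DistLE K u v (d u v)
  realised u v = sound ≤-refl

  connected : Connected K
  connected u v = d u v , proj₂ (proj₂ (realised u v))

-- Both notions are decidable, so a concrete table is certified by evaluation.
descent? : (K : Graph) (d : V K → V K → ℕ) → ∀ u v k → Dec (Descent K d u v k)
descent? K d u v zero    = u Fin.≟ v
descent? K d u v (suc k) = any? λ z → (adj K u z Bool.≟ true) ×-dec (d z v ℕ.≟ k)

isDistance? : (K : Graph) (d : V K → V K → ℕ) → Dec (IsDistance K d)
isDistance? K d = map′ (λ (o , l , s) → record { diagonal = o ; lipschitz = l ; descent = s })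
                       (λ t → IsDistance.diagonal t , IsDistance.lipschitz t , IsDistance.descent t)
  ( (all? λ u → d u u ℕ.≟ 0)
  ×-dec (all? λ u → all? λ z → all? λ w → (adj K u z Bool.≟ true) →-dec (d u w ≤? suc (d z w)))
  ×-dec (all? λ u → all? λ v → descent? K d u v (d u v)))

-- A Helly criterion.

TwoOf : {A : Set} → (A → Set) → A → A → A → Set
TwoOf P a b c = (P a × P b) ⊎ (P a × P c) ⊎ (P b × P c)

two-of-map : ∀ {A B : Set} {P : A → Set} {Q : B → Set} (f : A → B) →
  (∀ {x} → P x → Q (f x)) → ∀ {a b c} → TwoOf P a b c → TwoOf Q (f a) (f b) (f c)
two-of-map f g (inj₁ (p , q))        = inj₁ (g p , g q)
two-of-map f g (inj₂ (inj₁ (p , q))) = inj₂ (inj₁ (g p , g q))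
two-of-map f g (inj₂ (inj₂ (p , q))) = inj₂ (inj₂ (g p , g q))

Central : (K : Graph) → V K → V K → V K → V K → Set
Central K a b c w = ∀ v r → TwoOf (InDisk K v r) a b c → InDisk K v r w

TripleCondition : Graph → Set
TripleCondition K = ∀ a b c → ∃[ w ] Central K a b c w

HellyFor : Graph → ℕ → Set
HellyFor K m = ∀ (c : Fin m → V K) (r : Fin m → ℕ) →
  (∀ i j → ∃[ w ] (InDisk K (c i) (r i) w × InDisk K (c j) (r j) w)) →
  ∃[ w ] (∀ i → InDisk K (c i) (r i) w)

-- Berge's argument: for a family of at least three disks, the common points a₀,
-- a₁, a₂ of the subfamilies omitting disk 0, 1, 2 are such that every disk
-- contains two of them, so a central point of a₀, a₁, a₂ lies in all disks.
helly-step : ∀ {K m} → TripleCondition K → HellyFor K (2 + m) → HellyFor K (3 + m)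
helly-step {K} {m} triple helly c r meet = w , λ i → w-central (c i) (r i) (two-of i)
  where
  common-without : (j : Fin (3 + m)) → ∃[ a ] (∀ {i} → j ≢ i → InDisk K (c i) (r i) a)
  common-without j with helly (c ∘ punchIn j) (r ∘ punchIn j) (λ i i′ → meet (punchIn j i) (punchIn j i′))
  ... | a , in-a = a , λ {i} j≢i →
    subst (λ t → InDisk K (c t) (r t) a) (punchIn-punchOut j≢i) (in-a (punchOut j≢i))

  a : Fin (3 + m) → V K
  a j = proj₁ (common-without j)

  a∈ : ∀ j {i} → j ≢ i → InDisk K (c i) (r i) (a j)
  a∈ j = proj₂ (common-without j)

  w : V K
  w = proj₁ (triple (a 0F) (a 1F) (a 2F))

  w-central : Central K (a 0F) (a 1F) (a 2F) w
  w-central = proj₂ (triple (a 0F) (a 1F) (a 2F))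

  two-of : ∀ i → TwoOf (InDisk K (c i) (r i)) (a 0F) (a 1F) (a 2F)
  two-of 0F                              = inj₂ (inj₂ (a∈ 1F (λ ()) , a∈ 2F (λ ())))
  two-of 1F                              = inj₂ (inj₁ (a∈ 0F (λ ()) , a∈ 2F (λ ())))
  two-of 2F                              = inj₁ (a∈ 0F (λ ()) , a∈ 1F (λ ()))
  two-of (suc (suc (suc _))) = inj₁ (a∈ 0F (λ ()) , a∈ 1F (λ ()))

triple⇒helly : ∀ {K} → V K → TripleCondition K → Helly K
triple⇒helly v₀ triple zero                c r meet = v₀ , λ ()
triple⇒helly v₀ triple (suc zero)          c r meet = c 0F , λ { 0F → dist-refl }
triple⇒helly v₀ triple (suc (suc zero))    c r meet with meet 0F 1F
... | w , p , q = w , λ { 0F → p ; 1F → q }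
triple⇒helly v₀ triple (suc (suc (suc m))) = helly-step triple (triple⇒helly v₀ triple (suc (suc m)))

-- With a distance table, "w lies in every disk containing two of a, b, c"
-- says that d(v, w) is at most the median of d(v, a), d(v, b), d(v, c).
median : ℕ → ℕ → ℕ → ℕ
median x y z = (x ⊓ y) ⊔ (y ⊓ z) ⊔ (x ⊓ z)

median-bound : ∀ {x y z r} → TwoOf (_≤ r) x y z → median x y z ≤ r
median-bound {x} {y} {z} (inj₁ (x≤ , y≤)) =
  ⊔-lub (⊔-lub (≤-trans (m⊓n≤m x y) x≤) (≤-trans (m⊓n≤m y z) y≤)) (≤-trans (m⊓n≤m x z) x≤)
median-bound {x} {y} {z} (inj₂ (inj₁ (x≤ , z≤))) =
  ⊔-lub (⊔-lub (≤-trans (m⊓n≤m x y) x≤) (≤-trans (m⊓n≤n y z) z≤)) (≤-trans (m⊓n≤m x z) x≤)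
median-bound {x} {y} {z} (inj₂ (inj₂ (y≤ , z≤))) =
  ⊔-lub (⊔-lub (≤-trans (m⊓n≤n x y) y≤) (≤-trans (m⊓n≤m y z) y≤)) (≤-trans (m⊓n≤n x z) z≤)

MedianCondition : (K : Graph) → (V K → V K → ℕ) → Set
MedianCondition K d = ∀ a b c → ∃[ w ] ∀ v → d v w ≤ median (d v a) (d v b) (d v c)

median⇒triple : ∀ {K d} → IsDistance K d → MedianCondition K d → TripleCondition K
median⇒triple {K} {d} isDistance central a b c with central a b c
... | w , w-central = w , λ v r two →
  sound (≤-trans (w-central v) (median-bound (two-of-map {Q = _≤ r} (d v) complete two)))
  where open Distance isDistance

module _ {G K : Graph} (f : IsoEmb G K) where

  iso-to : ∀ {u v r} → DistLE G u v r → DistLE K (emb f u) (emb f v) r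
  iso-to {u} {v} {r} = proj₁ (proj₂ f u v r)

  iso-from : ∀ {u v r} → DistLE K (emb f u) (emb f v) r → DistLE G u v r
  iso-from {u} {v} {r} = proj₂ (proj₂ f u v r)

  iso-injective : ∀ {u v} → emb f u ≡ emb f v → u ≡ v
  iso-injective {u} eq = dist-zero (iso-from (subst (λ t → DistLE K (emb f u) t 0) eq dist-refl))

  iso-edge : ∀ {u v} → Edge G u v → Edge K (emb f u) (emb f v)
  iso-edge e = dist-edge {K} (iso-to (edge-dist {G} e)) (edge-distinct {G} e ∘ iso-injective)

  iso-far : ∀ {u v} → Far G u v → Far K (emb f u) (emb f v)
  iso-far far = far ∘ iso-from

iso-∘ : ∀ {G H K} → IsoEmb G H → IsoEmb H K → IsoEmb G K
iso-∘ f g = emb g ∘ emb f , λ u v r → iso-to g ∘ iso-to f , iso-from f ∘ iso-from g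

iso-from-tables : ∀ {G K dG dK} → IsDistance G dG → IsDistance K dK →
  (f : V G → V K) → (∀ u v → dG u v ≡ dK (f u) (f v)) → IsoEmb G K
iso-from-tables isG isK f agree = f , λ u v r →
  (λ p → K.sound (subst (_≤ r) (agree u v) (G.complete p))) ,
  (λ p → G.sound (subst (_≤ r) (≡.sym (agree u v)) (K.complete p)))
  where
  module G = Distance isG
  module K = Distance isK

iso-preserves-table : ∀ {G K dG dK} → IsDistance G dG → IsDistance K dK →
  (f : IsoEmb G K) → ∀ u v → dK (emb f u) (emb f v) ≡ dG u v
iso-preserves-table isG isK f u v =
  ≤-antisym (K.complete (iso-to f (G.realised u v))) (G.complete (iso-from f (K.realised _ _)))
  where
  module G = Distance isG
  module K = Distance isK

-- Forcing of edge orientations and permutation graphs.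

-- Gallai's relation Γ on oriented edges: ab forces cb (and ab forces ac) when
-- the two edges share an endpoint and their other endpoints are far apart.
data Forces (K : Graph) : V K × V K → V K × V K → Set where
  sameHead : ∀ {a b c} → Edge K a b → Edge K c b → Far K a c → Forces K (a , b) (c , b)
  sameTail : ∀ {a b c} → Edge K a b → Edge K a c → Far K b c → Forces K (a , b) (a , c)

SelfReversing : Graph → Set
SelfReversing K = ∃₂ λ a b → Edge K a b × Star (Forces K) (a , b) (b , a)

forces-reverse : ∀ {K p q} → Forces K p q → Forces K (swap p) (swap q)
forces-reverse {K} (sameHead e₁ e₂ far) = sameTail (edge-sym {K} e₁) (edge-sym {K} e₂) far
forces-reverse {K} (sameTail e₁ e₂ far) = sameHead (edge-sym {K} e₁) (edge-sym {K} e₂) far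

-- The order along the first line orients every edge of a permutation graph,
-- and this orientation is closed under Γ.
module Orientation {K : Graph} (model : PermutationGraph K) where
  π₁ π₂ : Permutation′ (n K)
  π₁ = proj₁ model
  π₂ = proj₁ (proj₂ model)

  position : V K → Fin (n K)
  position i = π₁ ⟨$⟩ʳ i

  Forward : V K × V K → Set
  Forward (a , b) = position a < position b

  position-injective : ∀ {a b} → position a ≡ position b → a ≡ b
  position-injective = Injection.injective (↔⇒↣ π₁)

  crossing : ∀ {a b} → Edge K a b → Cross π₁ π₂ a b
  crossing {a} {b} e = proj₁ (proj₂ (proj₂ model) a b (edge-distinct {K} e)) e

  no-crossing : ∀ {a c} → Far K a c → ¬ Cross π₁ π₂ a c
  no-crossing {a} {c} far cross = far (edge-dist {K} (proj₂ (proj₂ (proj₂ model) a c a≢c) cross))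
    where
    a≢c : a ≢ c
    a≢c refl = far dist-refl

  forces-forward : ∀ {p q} → Forces K p q → Forward p → Forward q
  forces-forward (sameHead {a} {b} {c} eab ecb far) a<b with crossing eab
  ... | inj₂ (b<a , _) = ⊥-elim (Fin.<-asym a<b b<a)
  ... | inj₁ (_ , b₂<a₂) with Fin.<-cmp (position c) (position b)
  ...   | tri< c<b _ _ = c<b
  ...   | tri≈ _ c≡b _ = ⊥-elim (edge-distinct {K} ecb (position-injective c≡b))
  ...   | tri> _ _ b<c with crossing ecb
  ...     | inj₁ (c<b , _)   = ⊥-elim (Fin.<-asym c<b b<c)
  ...     | inj₂ (_ , c₂<b₂) = ⊥-elim (no-crossing far (inj₁ (Fin.<-trans a<b b<c , Fin.<-trans c₂<b₂ b₂<a₂)))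
  forces-forward (sameTail {a} {b} {c} eab eac far) a<b with crossing eab
  ... | inj₂ (b<a , _) = ⊥-elim (Fin.<-asym a<b b<a)
  ... | inj₁ (_ , b₂<a₂) with Fin.<-cmp (position a) (position c)
  ...   | tri< a<c _ _ = a<c
  ...   | tri≈ _ a≡c _ = ⊥-elim (edge-distinct {K} eac (position-injective a≡c))
  ...   | tri> _ _ c<a with crossing eac
  ...     | inj₁ (a<c , _)   = ⊥-elim (Fin.<-asym a<c c<a)
  ...     | inj₂ (_ , a₂<c₂) = ⊥-elim (no-crossing far (inj₂ (Fin.<-trans c<a a<b , Fin.<-trans b₂<a₂ a₂<c₂)))

  forced-forward : ∀ {p q} → Star (Forces K) p q → Forward p → Forward q
  forced-forward ε        fwd = fwd
  forced-forward (γ ◅ γs) fwd = forced-forward γs (forces-forward γ fwd)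

  -- Whichever way the edge ab is oriented, the chain reverses it.
  reversal-impossible : ∀ {a b} → Edge K a b → ¬ Star (Forces K) (a , b) (b , a)
  reversal-impossible {a} {b} e chain with Fin.<-cmp (position a) (position b)
  ... | tri< a<b _ _ = Fin.<-asym a<b (forced-forward chain a<b)
  ... | tri≈ _ a≡b _ = edge-distinct {K} e (position-injective a≡b)
  ... | tri> _ _ b<a = Fin.<-asym b<a (forced-forward (gmap swap forces-reverse chain) b<a)

self-reversing⇒¬permutation : ∀ {K} → SelfReversing K → ¬ PermutationGraph K
self-reversing⇒¬permutation (a , b , e , chain) model = Orientation.reversal-impossible model e chain

self-reversing-iso : ∀ {H K} → IsoEmb H K → SelfReversing H → SelfReversing K
self-reversing-iso {H} {K} f (a , b , e , chain) =
  emb f a , emb f b , iso-edge f e , gmap both forces-image chain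
  where
  both : V H × V H → V K × V K
  both (u , v) = emb f u , emb f v

  forces-image : ∀ {p q} → Forces H p q → Forces K (both p) (both q)
  forces-image (sameHead e₁ e₂ far) = sameHead (iso-edge f e₁) (iso-edge f e₂) (iso-far f far)
  forces-image (sameTail e₁ e₂ far) = sameTail (iso-edge f e₁) (iso-edge f e₂) (iso-far f far)

-- Extending maps into Helly graphs.

Dominated : (H K : Graph) {m : ℕ} → (Fin m → V H) → (Fin m → V K) → Set
Dominated H K ι ψ = ∀ i j r → DistLE H (ι i) (ι j) r → DistLE K (ψ i) (ψ j) r

-- The disks D(ψ i, d(t, ι i)) pairwise meet because
-- d(ψ i, ψ j) ≤ d(ι i, ι j) ≤ d(t, ι i) + d(t, ι j); any common point will do.
extend : ∀ {H K d m} {ι : Fin m → V H} {ψ : Fin m → V K} → IsDistance H d → Helly K →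
  Dominated H K ι ψ → (t : V H) → ∃[ z ] Dominated H K (t Vector.∷ ι) (z Vector.∷ ψ)
extend {H} {K} {d} {m} {ι} {ψ} isDistance helly dominated t = z , dominated′
  where
  open Distance isDistance

  ρ : Fin m → ℕ
  ρ i = d t (ι i)

  meet : ∀ i j → ∃[ w ] (InDisk K (ψ i) (ρ i) w × InDisk K (ψ j) (ρ j) w)
  meet i j with disks-meet (ρ i) (ρ j)
                  (dominated i j _ (dist-trans (dist-sym (realised t (ι i))) (realised t (ι j))))
  ... | w , p , q = w , p , dist-sym q

  z : V K
  z = proj₁ (helly m ψ ρ meet)

  z-near : ∀ i r → DistLE H t (ι i) r → DistLE K z (ψ i) r
  z-near i r p = dist-mono (complete p) (dist-sym (proj₂ (helly m ψ ρ meet) i))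

  dominated′ : Dominated H K (t Vector.∷ ι) (z Vector.∷ ψ)
  dominated′ zero    zero    r _ = dist-refl
  dominated′ zero    (suc j) r p = z-near j r p
  dominated′ (suc i) zero    r p = dist-sym (z-near i r (dist-sym p))
  dominated′ (suc i) (suc j)     = dominated i j

-- Every distance of H is witnessed by anchors e a, e b: a geodesic from e a
-- to e b may pass through u and then v.
Witnessed : (H : Graph) → (V H → V H → ℕ) → {s : ℕ} → (Fin s → V H) → Set
Witnessed H d e = ∀ u v → ∃₂ λ a b → d (e a) u + d u v + d v (e b) ≤ d (e a) (e b)

rigid : ∀ {H K d s} {e : Fin s → V H} (φ : V H → V K) → IsDistance H d → Witnessed H d e →
  Dominated H K id φ → (∀ a b r → DistLE K (φ (e a)) (φ (e b)) r → DistLE H (e a) (e b) r) →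
  IsoEmb H K
rigid {H} {K} {d} {e = e} φ isDistance witnessed dominated reflects =
  φ , λ u v r → dominated u v r , λ p → sound (bound u v r p)
  where
  open Distance isDistance

  bound : ∀ u v r → DistLE K (φ u) (φ v) r → d u v ≤ r
  bound u v r p with witnessed u v
  ... | a , b , geodesic =
    +-cancelˡ-≤ (d (e a) u) (d u v) r (+-cancelʳ-≤ (d v (e b)) _ _ (≤-trans geodesic long))
    where
    detour : DistLE K (φ (e a)) (φ (e b)) (d (e a) u + r + d v (e b))
    detour = dist-trans (dist-trans (dominated (e a) u _ (realised (e a) u)) p) (dominated v (e b) _ (realised v (e b)))

    long : d (e a) (e b) ≤ d (e a) u + r + d v (e b)
    long = complete (reflects a b _ detour)

Resolving : (H : Graph) → (V H → V H → ℕ) → {s : ℕ} → (Fin s → V H) → Set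
Resolving H d e = ∀ u v → (∀ a → d u (e a) ≡ d v (e a)) → u ≡ v

fixes-all : ∀ {H d s} {e : Fin s → V H} → IsDistance H d → Resolving H d e →
  (σ : IsoEmb H H) → (∀ a → emb σ (e a) ≡ e a) → ∀ u → emb σ u ≡ u
fixes-all {d = d} {e = e} isDistance resolving σ fixed u = resolving (emb σ u) u profile
  where
  profile : ∀ a → d (emb σ u) (e a) ≡ d u (e a)
  profile a = ≡.trans (cong (d (emb σ u)) (≡.sym (fixed a))) (iso-preserves-table isDistance isDistance σ u (e a))

-- The example.

-- Distance matrix of H₈.  Vertices 2, …, 7 span G₆, vertices 1 and 0 are the
-- two points added by the injective hull; edges are the entries equal to 1.
distances : Vec (Vec ℕ 8) 8
distances = (0 ∷ 1 ∷ 2 ∷ 1 ∷ 2 ∷ 1 ∷ 1 ∷ 1 ∷ [])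
          ∷ (1 ∷ 0 ∷ 1 ∷ 1 ∷ 1 ∷ 2 ∷ 1 ∷ 2 ∷ [])
          ∷ (2 ∷ 1 ∷ 0 ∷ 2 ∷ 1 ∷ 2 ∷ 1 ∷ 3 ∷ [])
          ∷ (1 ∷ 1 ∷ 2 ∷ 0 ∷ 1 ∷ 2 ∷ 1 ∷ 1 ∷ [])
          ∷ (2 ∷ 1 ∷ 1 ∷ 1 ∷ 0 ∷ 3 ∷ 2 ∷ 2 ∷ [])
          ∷ (1 ∷ 2 ∷ 2 ∷ 2 ∷ 3 ∷ 0 ∷ 1 ∷ 1 ∷ [])
          ∷ (1 ∷ 1 ∷ 1 ∷ 1 ∷ 2 ∷ 1 ∷ 0 ∷ 2 ∷ [])
          ∷ (1 ∷ 2 ∷ 3 ∷ 1 ∷ 2 ∷ 1 ∷ 2 ∷ 0 ∷ [])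
          ∷ []

d₈ : Fin 8 → Fin 8 → ℕ
d₈ u v = lookup (lookup distances u) v

H₈ : Graph
H₈ = record
  { n      = 8
  ; adj    = λ u v → d₈ u v ≡ᵇ 1
  ; sym    = from-yes (all? λ u → all? λ v → (d₈ u v ≡ᵇ 1) Bool.≟ (d₈ v u ≡ᵇ 1))
  ; irrefl = from-yes (all? λ u → (d₈ u u ≡ᵇ 1) Bool.≟ false)
  }

ι : Fin 6 → Fin 8
ι a = suc (suc a)

G₆ : Graph
G₆ = record
  { n      = 6
  ; adj    = λ a b → adj H₈ (ι a) (ι b)
  ; sym    = λ a b → sym H₈ (ι a) (ι b)
  ; irrefl = λ a → irrefl H₈ (ι a)
  }

d₆ : Fin 6 → Fin 6 → ℕ
d₆ a b = d₈ (ι a) (ι b)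

H₈-distance : IsDistance H₈ d₈
H₈-distance = from-yes (isDistance? H₈ d₈)

G₆-distance : IsDistance G₆ d₆
G₆-distance = from-yes (isDistance? G₆ d₆)

ι-iso : IsoEmb G₆ H₈
ι-iso = iso-from-tables G₆-distance H₈-distance ι (λ _ _ → refl)

cross? : ∀ {m} (π₁ π₂ : Permutation′ m) i j → Dec (Cross π₁ π₂ i j)
cross? π₁ π₂ i j =
  ((π₁ ⟨$⟩ʳ i) Fin.<? (π₁ ⟨$⟩ʳ j) ×-dec (π₂ ⟨$⟩ʳ j) Fin.<? (π₂ ⟨$⟩ʳ i)) ⊎-dec
  ((π₁ ⟨$⟩ʳ j) Fin.<? (π₁ ⟨$⟩ʳ i) ×-dec (π₂ ⟨$⟩ʳ i) Fin.<? (π₂ ⟨$⟩ʳ j))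

G₆-permutation : PermutationGraph G₆
G₆-permutation = Perm.id , σ , λ i j _ → model i j
  where
  σ : Permutation′ 6
  σ = transpose 0F 2F ∘ₚ transpose 1F 4F ∘ₚ transpose 3F 5F

  model : ∀ i j → (Edge G₆ i j → Cross Perm.id σ i j) × (Cross Perm.id σ i j → Edge G₆ i j)
  model = from-yes (all? λ i → all? λ j →
    ((adj G₆ i j Bool.≟ true) →-dec cross? Perm.id σ i j) ×-dec (cross? Perm.id σ i j →-dec (adj G₆ i j Bool.≟ true)))

H₈-helly : Helly H₈
H₈-helly = triple⇒helly 0F (median⇒triple H₈-distance (from-yes (all? λ a → all? λ b → all? λ c →
  any? λ w → all? λ v → d₈ v w ≤? median (d₈ v a) (d₈ v b) (d₈ v c))))

-- Every Helly graph K containing G₆ isometrically contains H₈ isometrically,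
-- through an embedding extending that of G₆: place vertex 1, then vertex 0,
-- by hyperconvexity; the anchors 2, …, 7 witness every distance of H₈.
hull-embeds : ∀ {K} → Helly K → (f : IsoEmb G₆ K) → Σ (IsoEmb H₈ K) λ φ → ∀ a → emb φ (ι a) ≡ emb f a
hull-embeds {K} helly f = rigid φ H₈-distance witnessed dominated reflects , λ _ → refl
  where
  placed-x : ∃[ x ] Dominated H₈ K (1F Vector.∷ ι) (x Vector.∷ emb f)
  placed-x = extend H₈-distance helly (λ a b r → iso-to f ∘ iso-from ι-iso) 1F

  placed-y : ∃[ y ] Dominated H₈ K (0F Vector.∷ 1F Vector.∷ ι) (y Vector.∷ proj₁ placed-x Vector.∷ emb f)
  placed-y = extend H₈-distance helly (proj₂ placed-x) 0F

  φ : V H₈ → V K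
  φ = proj₁ placed-y Vector.∷ proj₁ placed-x Vector.∷ emb f

  enumerates : ∀ u → (0F Vector.∷ 1F Vector.∷ ι) u ≡ u
  enumerates 0F            = refl
  enumerates 1F            = refl
  enumerates (suc (suc a)) = refl

  dominated : Dominated H₈ K id φ
  dominated u v r p = proj₂ placed-y u v r
    (subst₂ (λ s t → DistLE H₈ s t r) (≡.sym (enumerates u)) (≡.sym (enumerates v)) p)

  witnessed : Witnessed H₈ d₈ ι
  witnessed = from-yes (all? λ u → all? λ v → any? λ a → any? λ b →
    d₈ (ι a) u + d₈ u v + d₈ v (ι b) ≤? d₈ (ι a) (ι b))

  reflects : ∀ a b r → DistLE K (φ (ι a)) (φ (ι b)) r → DistLE H₈ (ι a) (ι b) r
  reflects a b r = iso-to ι-iso ∘ iso-from f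

-- H₈ is minimal: an intermediate Helly graph H′ receives H₈ by hull-embeds,
-- and composing back into H₈ fixes the anchors, hence every vertex.
H₈-minimal : ∀ (H′ : Graph) (g : IsoEmb G₆ H′) (h : IsoEmb H′ H₈) → Helly H′ →
  (∀ u → emb h (emb g u) ≡ emb ι-iso u) → ∀ y → ∃[ x ] (emb h x ≡ y)
H₈-minimal H′ g h helly commutes y = emb φ y , fixes-all H₈-distance resolving (iso-∘ φ h) fixed y
  where
  φ : IsoEmb H₈ H′
  φ = proj₁ (hull-embeds helly g)

  resolving : Resolving H₈ d₈ ι
  resolving = from-yes (all? λ u → all? λ v →
    (all? λ a → d₈ u (ι a) ℕ.≟ d₈ v (ι a)) →-dec (u Fin.≟ v))

  fixed : ∀ a → emb h (emb φ (ι a)) ≡ ι a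
  fixed a = ≡.trans (cong (emb h) (proj₂ (hull-embeds helly g) a)) (commutes a)

far : ∀ u v → {True (1 <? d₈ u v)} → Far H₈ u v
far u v {1<d} p = <⇒≱ (toWitness 1<d) (Distance.complete H₈-distance p)

H₈-self-reversing : SelfReversing H₈
H₈-self-reversing = 2F , 1F , refl ,
  sameHead refl refl (far 2F 3F) ◅ sameTail refl refl (far 1F 7F) ◅ sameTail refl refl (far 7F 4F) ◅
  sameTail refl refl (far 4F 0F) ◅ sameHead refl refl (far 3F 5F) ◅ sameHead refl refl (far 5F 1F) ◅
  sameTail refl refl (far 0F 2F) ◅ ε

-- Any injective hull of G₆ contains H₈ isometrically, hence its Γ-chain.
hull-not-permutation : ∀ (K : Graph) (f : IsoEmb G₆ K) → IsInjectiveHull G₆ K f → ¬ PermutationGraph K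
hull-not-permutation K f (helly , _) =
  self-reversing⇒¬permutation (self-reversing-iso (proj₁ (hull-embeds helly f)) H₈-self-reversing)

lemma3 : Σ Graph λ G → PermutationGraph G × Connected G ×
           (Σ Graph λ H → Σ (IsoEmb G H) λ f → IsInjectiveHull G H f) ×
           (∀ (H : Graph) (f : IsoEmb G H) → IsInjectiveHull G H f → ¬ PermutationGraph H)
lemma3 =
  G₆ , G₆-permutation , Distance.connected G₆-distance ,
  (H₈ , ι-iso , H₈-helly , H₈-minimal) ,
  hull-not-permutation
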